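{- Let $\Sigma$ be a set of unary predicates, let $\mathfrak{A}$ be a structure interpreting $\Sigma\cup\{\mathfrak{t}\}$ with $\mathfrak{t}^{\mathfrak{A}}$ transitive, and let $\psi$ be a basic $\mathcal{FL}^21\mathrm{T}^u$-formula over $\Sigma\cup\{\mathfrak{t}\}$. If $\mathfrak{A}\models\psi$, then $C(\mathfrak{A})\models\psi$.
   Context: A 1-type over $\Sigma$ is a maximal consistent conjunction of literals $\pm p(x)$, $p\in\Sigma$; $\mathrm{tp}^{\mathfrak{A}}[a]$ is the 1-type of $a$; $\pi(y)$ is $\pi$ with $y$ substituted for $x$; $\mu$ ranges over quantifier-free $\Sigma$-formulas in the variable $x$. Basic formulas are those of the forms $\exists x.\mu$, $\forall x.\mu$, $\forall x(\pi\to\exists y(\mu(y)\wedge\pm\mathfrak{t}(x,y)))$, $\forall x(\pi\to\forall y(\pi'(y)\to\pm\mathfrak{t}(x,y)))$ with $\pi,\pi'$ 1-types. A super-type is a pair $\langle\pi,\Pi\rangle$ ($\pi$ a 1-type, $\Pi$ a set of 1-types); $\mathrm{stp}^{\mathfrak{A}}[a]=\langle\mathrm{tp}^{\mathfrak{A}}[a],\{\mathrm{tp}^{\mathfrak{A}}[b]:\mathfrak{A}\models\mathfrak{t}[a,b]\}\rangle$; $\mathrm{tp}(S)=\{\pi:\langle\pi,\Pi\rangle\in S\}$. $C(\mathfrak{A})=(S,\ll)$ where $S=\{\mathrm{stp}^{\mathfrak{A}}[a]:a\in A\}$ and $\pi\ll\pi'$ iff $\pi,\pi'$ are realized in $\mathfrak{A}$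 and $\mathfrak{A}\models\forall x(\pi\to\forall y(\pi'(y)\to\mathfrak{t}(x,y)))$. For a pair $C=(S,\ll)$ with $S$ a set of super-types and $\ll$ a relation on $\mathrm{tp}(S)$, and basic $\psi$, $C\models\psi$ means: (i) if $\psi=\forall x(\pi\to\exists y(\mu(y)\wedge\mathfrak{t}(x,y)))$, then for all $\Pi$ with $\langle\pi,\Pi\rangle\in S$ there is $\pi'\in\Pi$ with $\models\pi'\to\mu$; (ii) if $\psi=\forall x(\pi\to\forall y(\pi'(y)\to\mathfrak{t}(x,y)))$ and $\pi,\pi'\in\mathrm{tp}(S)$, then $\pi\ll\pi'$; (iii) if $\psi=\forall x(\pi\to\exists y(\mu(y)\wedge\neg\mathfrak{t}(x,y)))$, then for all $\langle\pi,\Pi\rangle\in S$ there is $\langle\pi',\Pi'\rangle\in S$ with $\models\pi'\to\mu$ and no $\alpha\in\{\pi\}\cup\Pi$ with $\alpha\ll\pi'$; (iv) if $\psi=\forall x(\pi\to\forall y(\pi'(y)\to\neg\mathfrak{t}(x,y)))$, then $\pi'\notin\Pi$ for all $\langle\pi,\Pi\rangle\in S$; (v) if $\psi=\exists x.\mu$, there is $\langle\pi,\Pi\rangle\in S$ with $\models\pi\to\mu$; (vi) if $\psi=\forall x.\mu$, then $\models\pi\to\mu$ for all $\langle\pi,\Pi\rangle\in S$. -}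

module Defs where

open import Data.Nat using (ℕ)
open import Data.Fin using (Fin)
open import Data.Bool using (Bool; true; false; not; _∧_; _∨_)
open import Data.Vec using (Vec; lookup; tabulate)
open import Data.Product using (Σ; ∃; _×_; _,_; proj₁; proj₂)
open import Relation.Nullary using (¬_)
open import Relation.Binary.PropositionalEquality using (_≡_)

-- Σ = Fin k : a finite set of k unary predicate symbols.

-- A 1-type over Σ: a maximal consistent conjunction of literals ±p(x),
-- represented by the sign vector (entry p is true iff the literal p(x) occurs).
OneType : ℕ → Set
OneType k = Vec Bool k

data QF (k : ℕ) : Set where
  tt ff : QF k
  atom  : Fin k → QF k
  neg   : QF k → QF k
  conj  : QF k → QF k → QF k
  disj  : QF k → QF k → QF k

eval : ∀ {k} → QF k → (Fin k → Bool) → Bool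
eval tt _ = true
eval ff _ = false
eval (atom p) v = v p
eval (neg μ) v = not (eval μ v)
eval (conj μ ν) v = eval μ v ∧ eval ν v
eval (disj μ ν) v = eval μ v ∨ eval ν v

Entails : ∀ {k} → OneType k → QF k → Set
Entails π μ = ∀ v → (∀ p → v p ≡ lookup π p) → eval μ v ≡ true

data Sign : Set where
  pos negt : Sign

data Basic (k : ℕ) : Set where
  exX     : QF k → Basic k
  allX    : QF k → Basic k
  allExT  : OneType k → QF k → Sign → Basic k       -- ∀x(π → ∃y(μ(y) ∧ ±t(x,y)))
  allAllT : OneType k → OneType k → Sign → Basic k  -- ∀x(π → ∀y(π'(y) → ±t(x,y)))

record Structure (k : ℕ) : Set₁ where
  field
    Carrier : Set
    pred    : Carrier → Fin k → Bool
    t       : Carrier → Carrier → Set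

  tp : Carrier → OneType k
  tp a = tabulate (pred a)

Transitive : ∀ {k} → Structure k → Set
Transitive 𝔄 = ∀ a b c → t a b → t b c → t a c
  where open Structure 𝔄

signed : Sign → Set → Set
signed pos  X = X
signed negt X = ¬ X

_⊨_ : ∀ {k} → Structure k → Basic k → Set
𝔄 ⊨ exX μ = ∃ λ a → eval μ (pred a) ≡ true
  where open Structure 𝔄
𝔄 ⊨ allX μ = ∀ a → eval μ (pred a) ≡ true
  where open Structure 𝔄
𝔄 ⊨ allExT π μ s =
  ∀ a → tp a ≡ π → ∃ λ b → eval μ (pred b) ≡ true × signed s (t a b)
  where open Structure 𝔄
𝔄 ⊨ allAllT π π' s =
  ∀ a → tp a ≡ π → ∀ b → tp b ≡ π' → signed s (t a b)
  where open Structure 𝔄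

-- Super-types ⟨π, Π⟩, with the set Π of 1-types given as a predicate.
SuperType : ℕ → Set₁
SuperType k = OneType k × (OneType k → Set)

-- A pair C = (S, ≪): the set S of super-types is given as the image of a
-- family indexed by Idx (⟨π,Π⟩ ∈ S iff ⟨π,Π⟩ = stp i for some i);
-- ≪ is a relation on 1-types (only its restriction to tp(S) matters).
record Pair (k : ℕ) : Set₁ where
  field
    Idx : Set
    stp : Idx → SuperType k
    _≪_ : OneType k → OneType k → Set

  InTp : OneType k → Set
  InTp π = ∃ λ i → proj₁ (stp i) ≡ π

_⊨ᶜ_ : ∀ {k} → Pair k → Basic k → Set
C ⊨ᶜ allExT π μ pos =
  ∀ i → proj₁ (stp i) ≡ π → ∃ λ π' → proj₂ (stp i) π' × Entails π' μ
  where open Pair C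
C ⊨ᶜ allAllT π π' pos = InTp π → InTp π' → π ≪ π'
  where open Pair C
C ⊨ᶜ allExT π μ negt =
  ∀ i → proj₁ (stp i) ≡ π →
    ∃ λ j → Entails (proj₁ (stp j)) μ
          × ¬ (π ≪ proj₁ (stp j))
          × (∀ α → proj₂ (stp i) α → ¬ (α ≪ proj₁ (stp j)))
  where open Pair C
C ⊨ᶜ allAllT π π' negt =
  ∀ i → proj₁ (stp i) ≡ π → ¬ proj₂ (stp i) π'
  where open Pair C
C ⊨ᶜ exX μ = ∃ λ i → Entails (proj₁ (stp i)) μ
  where open Pair C
C ⊨ᶜ allX μ = ∀ i → Entails (proj₁ (stp i)) μ
  where open Pair C

C⟨_⟩ : ∀ {k} → Structure k → Pair k
C⟨ 𝔄 ⟩ = record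
  { Idx = Carrier
  ; stp = λ a → tp a , (λ π → ∃ λ b → t a b × tp b ≡ π)
  ; _≪_ = λ π π' → (∃ λ a → tp a ≡ π) × (∃ λ b → tp b ≡ π')
                 × (∀ a b → tp a ≡ π → tp b ≡ π' → t a b)
  }
  where open Structure 𝔄

-- Each clause of C(𝔄) ⊨ ψ is witnessed by the very elements witnessing 𝔄 ⊨ ψ:
-- an element satisfying μ has a 1-type entailing μ, and its type lies in the
-- super-type of any t-predecessor.  The only non-local clause is (iii): if
-- ¬ t(a,b), then no α ∈ {tp a} ∪ Π can satisfy α ≪ tp b, since α ≪ tp b would
-- give t(c,b) for a t-successor c of a (or for a itself), and transitivity would
-- then give t(a,b).
module Submission where

open import Defs
open import Data.Nat using (ℕ)
open import Data.Fin using (Fin)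
open import Data.Bool using (Bool; true; not; _∧_; _∨_)
open import Data.Vec.Properties using (lookup∘tabulate)
open import Data.Product using (_,_)
open import Relation.Nullary using (¬_)
open import Relation.Binary.PropositionalEquality using (_≡_; refl; trans; cong; cong₂)

eval-cong : ∀ {k} (μ : QF k) {v w : Fin k → Bool} →
            (∀ p → v p ≡ w p) → eval μ v ≡ eval μ w
eval-cong tt         v≗w = refl
eval-cong ff         v≗w = refl
eval-cong (atom p)   v≗w = v≗w p
eval-cong (neg μ)    v≗w = cong not (eval-cong μ v≗w)
eval-cong (conj μ ν) v≗w = cong₂ _∧_ (eval-cong μ v≗w) (eval-cong ν v≗w)
eval-cong (disj μ ν) v≗w = cong₂ _∨_ (eval-cong μ v≗w) (eval-cong ν v≗w)

module _ {k : ℕ} (𝔄 : Structure k) where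
  open Structure 𝔄
  open Pair C⟨ 𝔄 ⟩ using (_≪_)

  tp-entails : ∀ (μ : QF k) a → eval μ (pred a) ≡ true → Entails (tp a) μ
  tp-entails μ a μa v v≗tp =
    trans (eval-cong μ (λ p → trans (v≗tp p) (lookup∘tabulate (pred a) p))) μa

  ≪-realised : ∀ {a b} → tp a ≪ tp b → t a b
  ≪-realised (_ , _ , a≪b) = a≪b _ _ refl refl

  ¬t⇒successor-¬≪ : Transitive 𝔄 → ∀ {a b c} → ¬ t a b → t a c → ¬ (tp c ≪ tp b)
  ¬t⇒successor-¬≪ trans-t {a} {b} {c} ¬ab ac c≪b =
    ¬ab (trans-t a c b ac (≪-realised c≪b))

lemma3 : ∀ {k : ℕ} (𝔄 : Structure k) → Transitive 𝔄 → (ψ : Basic k) →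
         𝔄 ⊨ ψ → C⟨ 𝔄 ⟩ ⊨ᶜ ψ
lemma3 𝔄 trans-t (exX μ) (a , μa) = a , tp-entails 𝔄 μ a μa
lemma3 𝔄 trans-t (allX μ) 𝔄⊨ψ a = tp-entails 𝔄 μ a (𝔄⊨ψ a)
lemma3 𝔄 trans-t (allExT π μ pos) 𝔄⊨ψ a a:π with 𝔄⊨ψ a a:π
... | b , μb , ab = Structure.tp 𝔄 b , (b , ab , refl) , tp-entails 𝔄 μ b μb
lemma3 𝔄 trans-t (allExT π μ negt) 𝔄⊨ψ a refl with 𝔄⊨ψ a refl
... | b , μb , ¬ab =
  b , tp-entails 𝔄 μ b μb
    , (λ a≪b → ¬ab (≪-realised 𝔄 a≪b))
    , λ { _ (c , ac , refl) → ¬t⇒successor-¬≪ 𝔄 trans-t ¬ab ac }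
lemma3 𝔄 trans-t (allAllT π π' pos) 𝔄⊨ψ (a , a:π) (b , b:π') =
  (a , a:π) , (b , b:π') , λ x y x:π y:π' → 𝔄⊨ψ x x:π y y:π'
lemma3 𝔄 trans-t (allAllT π π' negt) 𝔄⊨ψ a a:π (b , ab , b:π') = 𝔄⊨ψ a a:π b b:π' ab
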